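{- Let $\Sigma$ be a finite alphabet with $q>1$ letters. For $n,m\in\mathbb{N}$ and $w\in\Sigma^m$, let $\Sigma_w(n)$ be the number of words of length $n$ over $\Sigma$ that do not contain $w$ as a factor, and let $\mu(n,m)=\max\{\Sigma_w(n)\mid w\in\Sigma^m\}$. Then for all $n,m\in\mathbb{N}$, \[\mu(n,m)\leq q^n\left(1-\frac{1}{q^m}\right)^{\lfloor n/m\rfloor}.\]
   Context: $\mathbb{N}$ denotes the set of positive integers; $\Sigma^m$ is the set of words of length $m$ over $\Sigma$; a factor is a contiguous subword. -}

module Defs where

open import Data.Nat as ℕ using (ℕ; zero; suc; _^_; _⊔_; _<_; NonZero)
open import Data.Nat.Properties using (m^n≢0; <-trans)
open import Data.Nat.DivMod using (_/_)
open import Data.Fin using (Fin)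
open import Data.Fin.Properties using (_≟_)
open import Data.Vec using (Vec; []; _∷_; toList)
open import Data.List using (List; [_]; concatMap; map; filter; length; foldr; allFin)
open import Data.List.Relation.Binary.Infix.Heterogeneous using (Infix)
open import Data.List.Relation.Binary.Infix.Heterogeneous.Properties using (infix?)
open import Data.Integer using (+_)
open import Data.Rational as ℚ using (ℚ; 1ℚ; _-_; _*_)
open import Relation.Binary.PropositionalEquality using (_≡_)
open import Relation.Nullary using (¬_)
open import Relation.Nullary.Decidable using (¬?)

-- The alphabet Σ with q letters is Fin q; words of length n are Vec (Fin q) n.

allWords : (q n : ℕ) → List (Vec (Fin q) n)
allWords q zero    = [ [] ]
allWords q (suc n) = concatMap (λ a → map (a ∷_) (allWords q n)) (allFin q)

IsFactor : ∀ {q m n} → Vec (Fin q) m → Vec (Fin q) n → Set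
IsFactor w v = Infix _≡_ (toList w) (toList v)

avoidCount : ∀ {q m} → (w : Vec (Fin q) m) → (n : ℕ) → ℕ
avoidCount {q} w n =
  length (filter (λ v → ¬? (infix? _≟_ (toList w) (toList v))) (allWords q n))

μ : (q n m : ℕ) → ℕ
μ q n m = foldr _⊔_ 0 (map (λ w → avoidCount w n) (allWords q m))

toℚ : ℕ → ℚ
toℚ k = + k ℚ./ 1

pow : ℚ → ℕ → ℚ
pow x zero    = 1ℚ
pow x (suc k) = x * pow x k

bound : (q n m : ℕ) → 1 < q → .{{NonZero m}} → ℚ
bound q n m q>1 =
  toℚ (q ^ n) *
  pow (1ℚ - ((+ 1) ℚ./ (q ^ m)) {{m^n≢0 q m {{ℕ.>-nonZero (<-trans (ℕ.s≤s ℕ.z≤n) q>1)}}}}) (n / m)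

-- Cutting a word of length k m + r into k blocks of length m followed by a
-- tail of length r, a word avoiding w has no block equal to w and a tail
-- avoiding w. The words with that weaker property are counted exactly, as
-- (q^m - 1)^k q^r, and (q^m - 1)^k = q^{k m} (1 - 1/q^m)^k.
module Submission where

open import Defs
open import Data.Nat as ℕ using (ℕ; zero; suc; _+_; _*_; _∸_; _^_; _<_; NonZero; z≤n; s≤s)
import Data.Nat.Properties as ℕ
open import Data.Nat.DivMod using (_/_; _%_; m≡m%n+[m/n]*n)
open import Data.Nat.ListAction using (sum)
open import Data.Integer as ℤ using ()
import Data.Integer.Properties as ℤ
open import Data.Rational as ℚ using (1ℚ; toℚᵘ; _≤_)
import Data.Rational.Properties as ℚ
open import Data.Rational.Unnormalised as ℚᵘ using (mkℚᵘ; *≡*; *≤*)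
import Data.Rational.Unnormalised.Properties as ℚᵘ
open import Data.Rational.Solver using (module +-*-Solver)
open import Data.Fin using (Fin)
open import Data.Fin.Properties using (_≟_)
open import Data.Vec using (Vec; []; _∷_; toList; take; drop)
  renaming (_++_ to _++ᵛ_)
import Data.Vec.Properties as Vec
open import Data.List using (List; []; _∷_; _++_; concatMap; map; filter; length; allFin)
import Data.List.Properties as List
open import Data.List.Membership.Propositional using (_∈_)
open import Data.List.Membership.Propositional.Properties using (∈-allFin; ∈-map⁺; ∈-concat⁺′)
import Data.List.Relation.Unary.All as All
import Data.List.Relation.Unary.All.Properties as All
open import Data.List.Relation.Unary.Any as Any using (here)
open import Data.List.Relation.Binary.Infix.Heterogeneous using (Infix; _++ⁱ_; _ⁱ++_)
open import Data.List.Relation.Binary.Infix.Heterogeneous.Properties using (infix?; fromPointwise)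
open import Data.List.Relation.Binary.Pointwise using (≡⇒Pointwise-≡)
open import Data.Product using (_×_; _,_)
open import Relation.Binary.PropositionalEquality
open import Relation.Nullary using (¬_; yes; no; contradiction)
open import Relation.Nullary.Decidable using (¬?; _×-dec_)
open import Relation.Unary using (Decidable)

private variable
  A B : Set

count : {P : A → Set} → Decidable P → List A → ℕ
count P? xs = length (filter P? xs)

count-++ : {P : A → Set} (P? : Decidable P) (xs ys : List A) →
  count P? (xs ++ ys) ≡ count P? xs + count P? ys
count-++ P? xs ys = trans (cong length (List.filter-++ P? xs ys)) (List.length-++ (filter P? xs))

count-map : {P : B → Set} (P? : Decidable P) (f : A → B) (xs : List A) →
  count P? (map f xs) ≡ count (λ x → P? (f x)) xs
count-map P? f [] = refl
count-map P? f (x ∷ xs) with P? (f x)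
... | yes _ = cong suc (count-map P? f xs)
... | no _  = count-map P? f xs

count-concatMap : {P : B → Set} (P? : Decidable P) (f : A → List B) (xs : List A) →
  count P? (concatMap f xs) ≡ sum (map (λ x → count P? (f x)) xs)
count-concatMap P? f [] = refl
count-concatMap P? f (x ∷ xs) =
  trans (count-++ P? (f x) (concatMap f xs)) (cong (count P? (f x) +_) (count-concatMap P? f xs))

count-mono : {P Q : A → Set} (P? : Decidable P) (Q? : Decidable Q) →
  (∀ {x} → P x → Q x) → (xs : List A) → count P? xs ℕ.≤ count Q? xs
count-mono P? Q? P⇒Q [] = z≤n
count-mono P? Q? P⇒Q (x ∷ xs) with P? x | Q? x
... | yes _  | yes _  = s≤s (count-mono P? Q? P⇒Q xs)
... | yes px | no ¬qx = contradiction (P⇒Q px) ¬qx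
... | no _   | yes _  = ℕ.m≤n⇒m≤1+n (count-mono P? Q? P⇒Q xs)
... | no _   | no _   = count-mono P? Q? P⇒Q xs

count-yes-× : {C : Set} {Q : A → Set} (c : C) (Q? : Decidable Q) (xs : List A) →
  count (λ x → yes c ×-dec Q? x) xs ≡ count Q? xs
count-yes-× c Q? [] = refl
count-yes-× c Q? (x ∷ xs) with Q? x
... | yes _ = cong suc (count-yes-× c Q? xs)
... | no _  = count-yes-× c Q? xs

count-no-× : {C : Set} {Q : A → Set} (¬c : ¬ C) (Q? : Decidable Q) (xs : List A) →
  count (λ x → no ¬c ×-dec Q? x) xs ≡ 0
count-no-× ¬c Q? [] = refl
count-no-× ¬c Q? (x ∷ xs) = count-no-× ¬c Q? xs

length-concatMap : (f : A → List B) (xs : List A) →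
  length (concatMap f xs) ≡ sum (map (λ x → length (f x)) xs)
length-concatMap f [] = refl
length-concatMap f (x ∷ xs) =
  trans (List.length-++ (f x)) (cong (length (f x) +_) (length-concatMap f xs))

sum-map-const : (c : ℕ) (xs : List A) → sum (map (λ _ → c) xs) ≡ length xs * c
sum-map-const c [] = refl
sum-map-const c (x ∷ xs) = cong (c +_) (sum-map-const c xs)

sum-map-*ʳ : (f : A → ℕ) (c : ℕ) (xs : List A) →
  sum (map (λ x → f x * c) xs) ≡ sum (map f xs) * c
sum-map-*ʳ f c [] = refl
sum-map-*ʳ f c (x ∷ xs) =
  trans (cong (f x * c +_) (sum-map-*ʳ f c xs)) (sym (ℕ.*-distribʳ-+ c (f x) (sum (map f xs))))

module _ {q : ℕ} where

  Word : ℕ → Set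
  Word n = Vec (Fin q) n

  countWords : ∀ {n} {P : Word n → Set} → Decidable P → ℕ
  countWords {n} P? = count P? (allWords q n)

  length-allWords : ∀ n → length (allWords q n) ≡ q ^ n
  length-allWords zero = refl
  length-allWords (suc n) = begin
    length (concatMap (λ a → map (a ∷_) (allWords q n)) (allFin q))
      ≡⟨ length-concatMap (λ a → map (a ∷_) (allWords q n)) (allFin q) ⟩
    sum (map (λ a → length (map (a ∷_) (allWords q n))) (allFin q))
      ≡⟨ cong sum (List.map-cong (λ a → trans (List.length-map (a ∷_) (allWords q n)) (length-allWords n)) (allFin q)) ⟩
    sum (map (λ _ → q ^ n) (allFin q))
      ≡⟨ sum-map-const (q ^ n) (allFin q) ⟩
    length (allFin q) * q ^ n
      ≡⟨ cong (_* q ^ n) (List.length-tabulate {n = q} (λ i → i)) ⟩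
    q * q ^ n ∎
    where open ≡-Reasoning

  ∈-allWords : ∀ {n} (w : Word n) → w ∈ allWords q n
  ∈-allWords [] = here refl
  ∈-allWords (a ∷ w) =
    ∈-concat⁺′ (∈-map⁺ (a ∷_) (∈-allWords w)) (∈-map⁺ (λ a → map (a ∷_) (allWords q _)) (∈-allFin a))

  countWords-suc : ∀ {n} {P : Word (suc n) → Set} (P? : Decidable P) →
    countWords P? ≡ sum (map (λ a → countWords (λ v → P? (a ∷ v))) (allFin q))
  countWords-suc {n} P? =
    trans (count-concatMap P? (λ a → map (a ∷_) (allWords q n)) (allFin q))
          (cong sum (List.map-cong (λ a → count-map P? (a ∷_) (allWords q n)) (allFin q)))

  countWords-take-drop : ∀ m {j} {P : Word m → Set} {Q : Word j → Set}
    (P? : Decidable P) (Q? : Decidable Q) →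
    countWords {m + j} (λ v → P? (take m v) ×-dec Q? (drop m v)) ≡ countWords P? * countWords Q?
  countWords-take-drop zero {j} P? Q? with P? []
  ... | yes p  = trans (count-yes-× p Q? (allWords q j)) (sym (ℕ.+-identityʳ (countWords Q?)))
  ... | no ¬p = count-no-× ¬p Q? (allWords q j)
  countWords-take-drop (suc m) {j} P? Q? = begin
    countWords (λ v → P? (take (suc m) v) ×-dec Q? (drop (suc m) v))
      ≡⟨ countWords-suc (λ v → P? (take (suc m) v) ×-dec Q? (drop (suc m) v)) ⟩
    sum (map (λ a → countWords {m + j} (λ v → P? (a ∷ take m v) ×-dec Q? (drop m v))) (allFin q))
      ≡⟨ cong sum (List.map-cong (λ a → countWords-take-drop m (λ u → P? (a ∷ u)) Q?) (allFin q)) ⟩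
    sum (map (λ a → countWords (λ u → P? (a ∷ u)) * countWords Q?) (allFin q))
      ≡⟨ sum-map-*ʳ (λ a → countWords (λ u → P? (a ∷ u))) (countWords Q?) (allFin q) ⟩
    sum (map (λ a → countWords (λ u → P? (a ∷ u))) (allFin q)) * countWords Q?
      ≡⟨ cong (_* countWords Q?) (sym (countWords-suc P?)) ⟩
    countWords P? * countWords Q? ∎
    where open ≡-Reasoning

  ≢? : ∀ {m} (w : Word m) → Decidable (_≢ w)
  ≢? w u = ¬? (Vec.≡-dec _≟_ u w)

  countWords-≢ : ∀ {m} (w : Word m) → countWords (≢? w) ℕ.≤ q ^ m ∸ 1
  countWords-≢ {m} w = ℕ.suc[m]≤n⇒m≤pred[n] (subst (countWords (≢? w) <_) (length-allWords m)
    (List.filter-notAll (≢? w) (allWords q m)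
      (Any.map (λ w≡u u≢w → u≢w (sym w≡u)) (∈-allWords w))))

  avoids? : ∀ {m n} (w : Word m) → Decidable (λ (v : Word n) → ¬ IsFactor w v)
  avoids? w v = ¬? (infix? _≟_ (toList w) (toList v))

  IsFactor-refl : ∀ {m} (w : Word m) → IsFactor w w
  IsFactor-refl w = fromPointwise (≡⇒Pointwise-≡ refl)

  IsFactor-++ˡ : ∀ {m k j} {w : Word m} {u : Word k} → IsFactor w u → (v : Word j) → IsFactor w (u ++ᵛ v)
  IsFactor-++ˡ {w = w} {u} w⊑u v = subst (Infix _≡_ (toList w)) (sym (Vec.toList-++ u v)) (w⊑u ⁱ++ toList v)

  IsFactor-++ʳ : ∀ {m k j} {w : Word m} (u : Word k) {v : Word j} → IsFactor w v → IsFactor w (u ++ᵛ v)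
  IsFactor-++ʳ {w = w} u {v} w⊑v = subst (Infix _≡_ (toList w)) (sym (Vec.toList-++ u v)) (toList u ++ⁱ w⊑v)

  avoids-take-drop : ∀ {m} {w : Word m} {j} (v : Word (m + j)) → ¬ IsFactor w v →
    take m v ≢ w × ¬ IsFactor w (drop m v)
  avoids-take-drop {m} {w} v w⋢v =
      (λ { refl → w⋢v (subst (IsFactor w) v≡take++drop (IsFactor-++ˡ (IsFactor-refl w) (drop m v))) })
    , (λ w⊑drop → w⋢v (subst (IsFactor w) v≡take++drop (IsFactor-++ʳ (take m v) w⊑drop)))
    where v≡take++drop = Vec.take++drop≡id m v

  avoidCount-+ : ∀ {m} (w : Word m) j → avoidCount w (m + j) ℕ.≤ (q ^ m ∸ 1) * avoidCount w j
  avoidCount-+ {m} w j = begin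
    countWords {m + j} (avoids? w)
      ≤⟨ count-mono (avoids? w) (λ v → ≢? w (take m v) ×-dec avoids? w (drop m v))
                    (avoids-take-drop _) (allWords q (m + j)) ⟩
    countWords {m + j} (λ v → ≢? w (take m v) ×-dec avoids? w (drop m v))
      ≡⟨ countWords-take-drop m (≢? w) (avoids? w) ⟩
    countWords (≢? w) * avoidCount w j
      ≤⟨ ℕ.*-monoˡ-≤ (avoidCount w j) (countWords-≢ w) ⟩
    (q ^ m ∸ 1) * avoidCount w j ∎
    where open ℕ.≤-Reasoning

  avoidCount-≤ : ∀ {m} (w : Word m) k r → avoidCount w (k * m + r) ℕ.≤ (q ^ m ∸ 1) ^ k * q ^ r
  avoidCount-≤ {m} w zero r = begin
    avoidCount w r         ≤⟨ List.length-filter (avoids? w) (allWords q r) ⟩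
    length (allWords q r)  ≡⟨ length-allWords r ⟩
    q ^ r                  ≡⟨ sym (ℕ.*-identityˡ (q ^ r)) ⟩
    1 * q ^ r              ∎
    where open ℕ.≤-Reasoning
  avoidCount-≤ {m} w (suc k) r = begin
    avoidCount w ((m + k * m) + r)           ≡⟨ cong (avoidCount w) (ℕ.+-assoc m (k * m) r) ⟩
    avoidCount w (m + (k * m + r))           ≤⟨ avoidCount-+ w (k * m + r) ⟩
    (q ^ m ∸ 1) * avoidCount w (k * m + r)   ≤⟨ ℕ.*-monoʳ-≤ (q ^ m ∸ 1) (avoidCount-≤ w k r) ⟩
    (q ^ m ∸ 1) * ((q ^ m ∸ 1) ^ k * q ^ r)  ≡⟨ sym (ℕ.*-assoc (q ^ m ∸ 1) _ _) ⟩
    (q ^ m ∸ 1) ^ suc k * q ^ r              ∎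
    where open ℕ.≤-Reasoning

μ-≤ : ∀ q n m {b} → (∀ (w : Word {q} m) → avoidCount w n ℕ.≤ b) → μ q n m ℕ.≤ b
μ-≤ q n m {b} avoidCount≤b = List.foldr-preservesᵇ {P = ℕ._≤ b} ℕ.⊔-lub z≤n
  (All.map⁺ (All.universal avoidCount≤b (allWords q m)))

toℚᵘ-toℚ : ∀ a → toℚᵘ (toℚ a) ℚᵘ.≃ mkℚᵘ (ℤ.+ a) 0
toℚᵘ-toℚ a = ℚ.toℚᵘ-fromℚᵘ (mkℚᵘ (ℤ.+ a) 0)

toℚ-+ : ∀ a b → toℚ (a + b) ≡ toℚ a ℚ.+ toℚ b
toℚ-+ a b = ℚ.toℚᵘ-injective (begin-equality
  toℚᵘ (toℚ (a + b))                  ≃⟨ toℚᵘ-toℚ (a + b) ⟩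
  mkℚᵘ (ℤ.+ (a + b)) 0                ≃⟨ *≡* (cong (ℤ._* ℤ.+ 1) pos-+-unit) ⟩
  mkℚᵘ (ℤ.+ a) 0 ℚᵘ.+ mkℚᵘ (ℤ.+ b) 0  ≃⟨ ℚᵘ.+-cong (toℚᵘ-toℚ a) (toℚᵘ-toℚ b) ⟨
  toℚᵘ (toℚ a) ℚᵘ.+ toℚᵘ (toℚ b)      ≃⟨ ℚ.toℚᵘ-homo-+ (toℚ a) (toℚ b) ⟨
  toℚᵘ (toℚ a ℚ.+ toℚ b)              ∎)
  where
  open ℚᵘ.≤-Reasoning
  pos-+-unit : ℤ.+ (a + b) ≡ ℤ.+ a ℤ.* ℤ.+ 1 ℤ.+ ℤ.+ b ℤ.* ℤ.+ 1
  pos-+-unit = trans (ℤ.pos-+ a b) (sym (cong₂ ℤ._+_ (ℤ.*-identityʳ (ℤ.+ a)) (ℤ.*-identityʳ (ℤ.+ b))))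

toℚ-* : ∀ a b → toℚ (a * b) ≡ toℚ a ℚ.* toℚ b
toℚ-* a b = ℚ.toℚᵘ-injective (begin-equality
  toℚᵘ (toℚ (a * b))                  ≃⟨ toℚᵘ-toℚ (a * b) ⟩
  mkℚᵘ (ℤ.+ (a * b)) 0                ≃⟨ *≡* (cong (ℤ._* ℤ.+ 1) (ℤ.pos-* a b)) ⟩
  mkℚᵘ (ℤ.+ a) 0 ℚᵘ.* mkℚᵘ (ℤ.+ b) 0  ≃⟨ ℚᵘ.*-cong (toℚᵘ-toℚ a) (toℚᵘ-toℚ b) ⟨
  toℚᵘ (toℚ a) ℚᵘ.* toℚᵘ (toℚ b)      ≃⟨ ℚ.toℚᵘ-homo-* (toℚ a) (toℚ b) ⟨
  toℚᵘ (toℚ a ℚ.* toℚ b)              ∎)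
  where open ℚᵘ.≤-Reasoning

toℚ-^ : ∀ a k → toℚ (a ^ k) ≡ pow (toℚ a) k
toℚ-^ a zero    = refl
toℚ-^ a (suc k) = trans (toℚ-* a (a ^ k)) (cong (toℚ a ℚ.*_) (toℚ-^ a k))

toℚ-mono-≤ : ∀ {a b} → a ℕ.≤ b → toℚ a ≤ toℚ b
toℚ-mono-≤ {a} {b} a≤b = ℚ.toℚᵘ-cancel-≤ (begin
  toℚᵘ (toℚ a)          ≃⟨ toℚᵘ-toℚ a ⟩
  mkℚᵘ (ℤ.+ a) 0        ≤⟨ *≤* (ℤ.*-monoʳ-≤-nonNeg (ℤ.+ 1) (ℤ.+≤+ a≤b)) ⟩
  mkℚᵘ (ℤ.+ b) 0        ≃⟨ toℚᵘ-toℚ b ⟨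
  toℚᵘ (toℚ b)          ∎)
  where open ℚᵘ.≤-Reasoning

pow-distribʳ-* : ∀ x y k → pow (x ℚ.* y) k ≡ pow x k ℚ.* pow y k
pow-distribʳ-* x y zero    = sym (ℚ.*-identityˡ 1ℚ)
pow-distribʳ-* x y (suc k) = begin
  (x ℚ.* y) ℚ.* pow (x ℚ.* y) k          ≡⟨ cong ((x ℚ.* y) ℚ.*_) (pow-distribʳ-* x y k) ⟩
  (x ℚ.* y) ℚ.* (pow x k ℚ.* pow y k)    ≡⟨ solve 4 (λ x y a b → (x :* y) :* (a :* b) := (x :* a) :* (y :* b))
                                                    refl x y (pow x k) (pow y k) ⟩
  (x ℚ.* pow x k) ℚ.* (y ℚ.* pow y k)    ∎
  where
  open ≡-Reasoning
  open +-*-Solver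

1/n*n≡1 : ∀ n .{{_ : NonZero n}} → (ℤ.+ 1 ℚ./ n) ℚ.* toℚ n ≡ 1ℚ
1/n*n≡1 n@(suc p) = ℚ.toℚᵘ-injective (begin-equality
  toℚᵘ ((ℤ.+ 1 ℚ./ n) ℚ.* toℚ n)            ≃⟨ ℚ.toℚᵘ-homo-* (ℤ.+ 1 ℚ./ n) (toℚ n) ⟩
  toℚᵘ (ℤ.+ 1 ℚ./ n) ℚᵘ.* toℚᵘ (toℚ n)      ≃⟨ ℚᵘ.*-cong (ℚ.toℚᵘ-fromℚᵘ (mkℚᵘ (ℤ.+ 1) p)) (toℚᵘ-toℚ n) ⟩
  mkℚᵘ (ℤ.+ 1) p ℚᵘ.* mkℚᵘ (ℤ.+ n) 0        ≃⟨ *≡* (cong ℤ.+[1+_] cross-multiplied) ⟩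
  toℚᵘ 1ℚ                                    ∎)
  where
  open ℚᵘ.≤-Reasoning
  cross-multiplied : (p + 0) * 1 ≡ p * 1 + 0
  cross-multiplied = trans (cong (_* 1) (ℕ.+-identityʳ p)) (sym (ℕ.+-identityʳ (p * 1)))

[1-1/n]*n≡n∸1 : ∀ n .{{_ : NonZero n}} → (1ℚ ℚ.- ℤ.+ 1 ℚ./ n) ℚ.* toℚ n ≡ toℚ (n ∸ 1)
[1-1/n]*n≡n∸1 n@(suc p) = begin
  (1ℚ ℚ.- u) ℚ.* toℚ n           ≡⟨ solve 2 (λ u n → (con 1ℚ :- u) :* n := n :- u :* n) refl u (toℚ n) ⟩
  toℚ n ℚ.- u ℚ.* toℚ n          ≡⟨ cong (λ v → toℚ n ℚ.- v) (1/n*n≡1 n) ⟩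
  toℚ (1 + p) ℚ.- 1ℚ             ≡⟨ cong (ℚ._- 1ℚ) (toℚ-+ 1 p) ⟩
  (1ℚ ℚ.+ toℚ p) ℚ.- 1ℚ          ≡⟨ solve 1 (λ x → (con 1ℚ :+ x) :- con 1ℚ := x) refl (toℚ p) ⟩
  toℚ p                          ∎
  where
  open ≡-Reasoning
  open +-*-Solver
  u = ℤ.+ 1 ℚ./ n

pow[1-1/n]*n^k≡[n∸1]^k : ∀ n .{{_ : NonZero n}} k →
  pow (1ℚ ℚ.- ℤ.+ 1 ℚ./ n) k ℚ.* toℚ (n ^ k) ≡ toℚ ((n ∸ 1) ^ k)
pow[1-1/n]*n^k≡[n∸1]^k n k = begin
  pow x k ℚ.* toℚ (n ^ k)       ≡⟨ cong (pow x k ℚ.*_) (toℚ-^ n k) ⟩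
  pow x k ℚ.* pow (toℚ n) k     ≡⟨ pow-distribʳ-* x (toℚ n) k ⟨
  pow (x ℚ.* toℚ n) k           ≡⟨ cong (λ y → pow y k) ([1-1/n]*n≡n∸1 n) ⟩
  pow (toℚ (n ∸ 1)) k           ≡⟨ toℚ-^ (n ∸ 1) k ⟨
  toℚ ((n ∸ 1) ^ k)             ∎
  where
  open ≡-Reasoning
  x = 1ℚ ℚ.- ℤ.+ 1 ℚ./ n

n≡[n/m]*m+n%m : ∀ n m .{{_ : NonZero m}} → n ≡ n / m * m + n % m
n≡[n/m]*m+n%m n m = trans (m≡m%n+[m/n]*n n m) (ℕ.+-comm (n % m) (n / m * m))

q^n≡[q^m]^[n/m]*q^[n%m] : ∀ q n m .{{_ : NonZero m}} → q ^ n ≡ (q ^ m) ^ (n / m) * q ^ (n % m)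
q^n≡[q^m]^[n/m]*q^[n%m] q n m = begin
  q ^ n                              ≡⟨ cong (q ^_) (n≡[n/m]*m+n%m n m) ⟩
  q ^ (n / m * m + n % m)            ≡⟨ ℕ.^-distribˡ-+-* q (n / m * m) (n % m) ⟩
  q ^ (n / m * m) * q ^ (n % m)      ≡⟨ cong (λ e → q ^ e * q ^ (n % m)) (ℕ.*-comm (n / m) m) ⟩
  q ^ (m * (n / m)) * q ^ (n % m)    ≡⟨ cong (_* q ^ (n % m)) (ℕ.^-*-assoc q m (n / m)) ⟨
  (q ^ m) ^ (n / m) * q ^ (n % m)    ∎
  where open ≡-Reasoning

bound≡toℚ : ∀ q n m (q>1 : 1 < q) .{{_ : NonZero m}} →
  bound q n m q>1 ≡ toℚ ((q ^ m ∸ 1) ^ (n / m) * q ^ (n % m))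
bound≡toℚ q n m q>1 = begin
  toℚ (q ^ n) ℚ.* p                                ≡⟨ cong (λ a → toℚ a ℚ.* p) (q^n≡[q^m]^[n/m]*q^[n%m] q n m) ⟩
  toℚ ((q ^ m) ^ k * q ^ r) ℚ.* p                  ≡⟨ cong (ℚ._* p) (toℚ-* ((q ^ m) ^ k) (q ^ r)) ⟩
  (toℚ ((q ^ m) ^ k) ℚ.* toℚ (q ^ r)) ℚ.* p        ≡⟨ solve 3 (λ a b c → (a :* b) :* c := (c :* a) :* b)
                                                              refl (toℚ ((q ^ m) ^ k)) (toℚ (q ^ r)) p ⟩
  (p ℚ.* toℚ ((q ^ m) ^ k)) ℚ.* toℚ (q ^ r)        ≡⟨ cong (ℚ._* toℚ (q ^ r)) (pow[1-1/n]*n^k≡[n∸1]^k (q ^ m) k) ⟩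
  toℚ ((q ^ m ∸ 1) ^ k) ℚ.* toℚ (q ^ r)            ≡⟨ toℚ-* ((q ^ m ∸ 1) ^ k) (q ^ r) ⟨
  toℚ ((q ^ m ∸ 1) ^ k * q ^ r)                    ∎
  where
  open ≡-Reasoning
  open +-*-Solver
  instance
    q^m≢0 : NonZero (q ^ m)
    q^m≢0 = ℕ.m^n≢0 q m {{ℕ.>-nonZero (ℕ.<-trans ℕ.z<s q>1)}}
  k = n / m
  r = n % m
  p = pow (1ℚ ℚ.- ℤ.+ 1 ℚ./ (q ^ m)) k

lemma1 : (q : ℕ) (q>1 : 1 < q) (n m : ℕ) .{{_ : NonZero n}} .{{_ : NonZero m}} →
    toℚ (μ q n m) ≤ bound q n m q>1
lemma1 q q>1 n m = subst (toℚ (μ q n m) ≤_) (sym (bound≡toℚ q n m q>1)) (toℚ-mono-≤ (μ-≤ q n m avoidCount≤b))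
  where
  b = (q ^ m ∸ 1) ^ (n / m) * q ^ (n % m)
  avoidCount≤b : (w : Word m) → avoidCount w n ℕ.≤ b
  avoidCount≤b w = subst (λ l → avoidCount w l ℕ.≤ b) (sym (n≡[n/m]*m+n%m n m)) (avoidCount-≤ w (n / m) (n % m))
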